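{- In $\Lambda=O_K[[T]]$: 1) for all $n\ge1$, $(\pi,T)^{2n}\subset(\pi^n,T^n)\subset(\pi,T)^n$; 2) for all $n\ge1$, $\omega_n(T)\in(p^{[n/2]},T^{p^{[n/2]+1}})$; 3) for $N\ge1$, with $n=[\mathrm{Log}(N)/\mathrm{Log}(p)]$, $T^N\in(p^{[n/2]},\omega_{[n/2]+1}(T))$.
   Context: $p$ is an odd prime, $K$ a finite extension of $\mathbb Q_p$, $O_K$ its valuation ring, and $\pi$ a uniformizer. $(x,y)$ denotes the ideal generated by $x,y$ in $\Lambda$. $\omega_n(T)=(1+T)^{p^n}-1$. $[x]$ is the integer part of a real $x$, and $\mathrm{Log}$ is the real logarithm. -}

module Defs where

open import Level using (Level; _⊔_)
open import Algebra.Bundles using (CommutativeRing)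
open import Data.Nat as ℕ using (ℕ; zero; suc; _∸_)
open import Data.Fin using (Fin; toℕ)
open import Data.Product using (∃)

-- Formal power series Λ = R[[T]] over a commutative ring R (standing for O_K),
-- represented by their coefficient sequences, with coefficientwise equality.
module PowerSeries {c ℓ : Level} (R : CommutativeRing c ℓ) where
  open CommutativeRing R using (_≈_; _+_; _*_; _-_; 0#; 1#) renaming (Carrier to A)

  PS : Set c
  PS = ℕ → A

  infix 4 _≈ₚ_
  _≈ₚ_ : PS → PS → Set ℓ
  f ≈ₚ g = ∀ k → f k ≈ g k

  sumTo : ℕ → (ℕ → A) → A
  sumTo zero    h = h zero
  sumTo (suc n) h = sumTo n h + h (suc n)

  sumFin : ∀ {m} → (Fin m → A) → A
  sumFin {zero}  h = 0#
  sumFin {suc m} h = h Data.Fin.zero + sumFin (λ i → h (Data.Fin.suc i))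

  C : A → PS
  C a zero    = a
  C a (suc k) = 0#

  𝟘ₚ 𝟙ₚ T : PS
  𝟘ₚ = C 0#
  𝟙ₚ = C 1#
  T zero          = 0#
  T (suc zero)    = 1#
  T (suc (suc k)) = 0#

  _+ₚ_ _-ₚ_ _*ₚ_ : PS → PS → PS
  (f +ₚ g) k = f k + g k
  (f -ₚ g) k = f k - g k
  (f *ₚ g) k = sumTo k (λ i → f i * g (k ∸ i))

  infixl 6 _+ₚ_ _-ₚ_
  infixl 7 _*ₚ_
  infixr 8 _^ₚ_

  _^ₚ_ : PS → ℕ → PS
  f ^ₚ zero  = 𝟙ₚ
  f ^ₚ suc n = f *ₚ (f ^ₚ n)

  natR : ℕ → A
  natR zero    = 0#
  natR (suc n) = 1# + natR n

  ΣFin : ∀ {m} → (Fin m → PS) → PS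
  ΣFin h k = sumFin (λ i → h i k)

  _∈⟨_⟩ : ∀ {m} → PS → (Fin m → PS) → Set (c ⊔ ℓ)
  x ∈⟨ g ⟩ = ∃ λ (u : Fin _ → PS) → x ≈ₚ ΣFin (λ i → u i *ₚ g i)

  _⊆⟨⟩_ : ∀ {m m'} → (Fin m → PS) → (Fin m' → PS) → Set (c ⊔ ℓ)
  g ⊆⟨⟩ h = ∀ x → x ∈⟨ g ⟩ → x ∈⟨ h ⟩

  ⟨_,_⟩ : PS → PS → Fin 2 → PS
  ⟨ x , y ⟩ Data.Fin.zero        = x
  ⟨ x , y ⟩ (Data.Fin.suc _)     = y

  -- generators of (π,T)^n : the products π^i T^(n-i), 0 ≤ i ≤ n
  maxPow : A → (n : ℕ) → Fin (suc n) → PS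
  maxPow π n i = (C π ^ₚ toℕ i) *ₚ (T ^ₚ (n ∸ toℕ i))

  ω : ℕ → ℕ → PS
  ω p n = ((𝟙ₚ +ₚ T) ^ₚ (p ℕ.^ n)) -ₚ 𝟙ₚ

-- (π,T)^(2n) ⊆ (π^n,T^n) ⊆ (π,T)^n is checked generator by generator. For 0 < k < p^(m+1)
-- the identity k·C(p^n,k) = p^n·C(p^n−1,k−1) gives p^(n−m) ∣ C(p^n,k), since at most m
-- factors p divide k. So when 2m ≤ n all coefficients of ω_n below degree p^(m+1) are
-- divisible by p^m, i.e. ω_n ∈ (p^m, T^(p^(m+1))). For n = m+1 this reads
-- T^(p^(m+1)) = ω_(m+1) − p·g, and its m-th power puts T^(m·p^(m+1)), hence every T^N with
-- N ≥ p^(2m), into (p^m, ω_(m+1)).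
{-# OPTIONS --safe #-}
module Submission where

open import Defs
open import Level using (Level)
open import Algebra.Bundles using (CommutativeRing; CommutativeSemiring; Semiring)
open import Data.Product using (Σ; ∃₂; _,_; proj₁; proj₂)

module BinomialDivisibility where

  open import Data.Nat
  open import Data.Nat.Properties
  open import Data.Nat.Divisibility
  open import Data.Nat.Primality using (Prime; euclidsLemma; prime⇒nonZero)
  open import Data.Nat.Combinatorics using (_C_; nC1≡n; nCk+nC[k+1]≡[n+1]C[k+1])
  open import Data.Sum using (inj₁; inj₂)
  open import Data.Empty using (⊥-elim)
  open import Relation.Nullary using (yes; no; ¬_)
  open import Relation.Binary.PropositionalEquality
  open import Data.Nat.Solver using (module +-*-Solver)
  open +-*-Solver

  [1+k]*[1+n]C[1+k]≡[1+n]*nCk : ∀ n k → suc k * (suc n C suc k) ≡ suc n * (n C k)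
  [1+k]*[1+n]C[1+k]≡[1+n]*nCk zero    zero    = refl
  [1+k]*[1+n]C[1+k]≡[1+n]*nCk zero    (suc k) = *-zeroʳ (2 + k)
  [1+k]*[1+n]C[1+k]≡[1+n]*nCk (suc n) zero    = begin
    1 * ((2 + n) C 1) ≡⟨ *-identityˡ _ ⟩
    (2 + n) C 1       ≡⟨ nC1≡n (2 + n) ⟩
    2 + n             ≡⟨ *-identityʳ (2 + n) ⟨
    (2 + n) * 1       ∎
    where open ≡-Reasoning
  [1+k]*[1+n]C[1+k]≡[1+n]*nCk (suc n) (suc k) = begin
    (2 + k) * ((2 + n) C (2 + k))
      ≡⟨ cong ((2 + k) *_) (nCk+nC[k+1]≡[n+1]C[k+1] (suc n) (suc k)) ⟨
    (2 + k) * (a + b)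
      ≡⟨ solve 3 (λ k a b → (con 2 :+ k) :* (a :+ b) := (con 1 :+ k) :* a :+ a :+ (con 2 :+ k) :* b) refl k a b ⟩
    (1 + k) * a + a + (2 + k) * b
      ≡⟨ cong₂ (λ u v → u + a + v) ([1+k]*[1+n]C[1+k]≡[1+n]*nCk n k) ([1+k]*[1+n]C[1+k]≡[1+n]*nCk n (suc k)) ⟩
    (1 + n) * (n C k) + a + (1 + n) * (n C suc k)
      ≡⟨ solve 4 (λ n a x y → (con 1 :+ n) :* x :+ a :+ (con 1 :+ n) :* y := a :+ (con 1 :+ n) :* (x :+ y)) refl n a (n C k) (n C suc k) ⟩
    a + (1 + n) * (n C k + n C suc k)
      ≡⟨ cong (λ x → a + (1 + n) * x) (nCk+nC[k+1]≡[n+1]C[k+1] n k) ⟩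
    (2 + n) * a ∎
    where
    open ≡-Reasoning
    a = suc n C suc k
    b = suc n C suc (suc k)

  n∣[1+k]*nC[1+k] : ∀ n k → n ∣ suc k * (n C suc k)
  n∣[1+k]*nC[1+k] zero    k = subst (0 ∣_) (sym (*-zeroʳ (suc k))) ∣-refl
  n∣[1+k]*nC[1+k] (suc n) k = divides (n C k) (trans ([1+k]*[1+n]C[1+k]≡[1+n]*nCk n k) (*-comm (suc n) _))

  p^a∣p^b : ∀ p {a b} → a ≤ b → p ^ a ∣ p ^ b
  p^a∣p^b p {a} {b} a≤b = divides (p ^ (b ∸ a)) (begin
    p ^ b                 ≡⟨ cong (p ^_) (m+[n∸m]≡n a≤b) ⟨
    p ^ (a + (b ∸ a))     ≡⟨ ^-distribˡ-+-* p a (b ∸ a) ⟩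
    p ^ a * p ^ (b ∸ a)   ≡⟨ *-comm (p ^ a) _ ⟩
    p ^ (b ∸ a) * p ^ a   ∎)
    where open ≡-Reasoning

  module _ {p : ℕ} (p-prime : Prime p) where
    private instance _ = prime⇒nonZero p-prime

    p^a∣k*b⇒p^a∣b : ∀ a {k b} → ¬ p ∣ k → p ^ a ∣ k * b → p ^ a ∣ b
    p^a∣k*b⇒p^a∣b zero    _ _ = 1∣ _
    p^a∣k*b⇒p^a∣b (suc a) {k} {b} p∤k p^[1+a]∣kb
      with euclidsLemma k b p-prime (∣-trans (m∣m*n (p ^ a)) p^[1+a]∣kb)
    ... | inj₁ p∣k = ⊥-elim (p∤k p∣k)
    ... | inj₂ (divides q refl) = subst (p * p ^ a ∣_) (*-comm p q)
      (*-monoʳ-∣ p (p^a∣k*b⇒p^a∣b a p∤k (*-cancelˡ-∣ p (subst (p * p ^ a ∣_) k*[q*p]≡p*[k*q] p^[1+a]∣kb))))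
      where
      k*[q*p]≡p*[k*q] : k * (q * p) ≡ p * (k * q)
      k*[q*p]≡p*[k*q] = solve 3 (λ k q p → k :* (q :* p) := p :* (k :* q)) refl k q p

    -- As k < p ^ (1 + v), at most v factors p divide k.
    p^a∣k*b⇒p^[a∸v]∣b : ∀ v a {k b} → 0 < k → k < p ^ suc v → p ^ a ∣ k * b → p ^ (a ∸ v) ∣ b
    p^a∣k*b⇒p^[a∸v]∣b v a {k} {b} 0<k k<p^[1+v] p^a∣kb with p ∣? k
    ... | no p∤k = ∣-trans (p^a∣p^b p (m∸n≤m a v)) (p^a∣k*b⇒p^a∣b a p∤k p^a∣kb)
    p^a∣k*b⇒p^[a∸v]∣b zero a {k} 0<k k<p^1 _ | yes p∣k =
      ⊥-elim (<⇒≱ (subst (k <_) (*-identityʳ p) k<p^1) (∣⇒≤ {{>-nonZero 0<k}} p∣k))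
    p^a∣k*b⇒p^[a∸v]∣b (suc v) zero    _ _ _ | yes _ = 1∣ _
    p^a∣k*b⇒p^[a∸v]∣b (suc v) (suc a) {_} {b} 0<k k<p^[2+v] p^[1+a]∣kb | yes (divides k′ refl) =
      p^a∣k*b⇒p^[a∸v]∣b v a 0<k′ k′<p^[1+v]
        (*-cancelˡ-∣ p (subst (p * p ^ a ∣_) [k′*p]*b≡p*[k′*b] p^[1+a]∣kb))
      where
      [k′*p]*b≡p*[k′*b] : (k′ * p) * b ≡ p * (k′ * b)
      [k′*p]*b≡p*[k′*b] = solve 3 (λ k q p → (k :* p) :* q := p :* (k :* q)) refl k′ b p
      0<k′ : 0 < k′
      0<k′ = >-nonZero⁻¹ k′ {{m*n≢0⇒m≢0 k′ {{>-nonZero 0<k}}}}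
      k′<p^[1+v] : k′ < p ^ suc v
      k′<p^[1+v] = *-cancelʳ-< p k′ (p ^ suc v) (subst (k′ * p <_) (*-comm p (p ^ suc v)) k<p^[2+v])

    p^[n∸v]∣p^nCk : ∀ n v {k} → 0 < k → k < p ^ suc v → p ^ (n ∸ v) ∣ p ^ n C k
    p^[n∸v]∣p^nCk n v {suc k} 0<k k<p^[1+v] =
      p^a∣k*b⇒p^[a∸v]∣b v n 0<k k<p^[1+v] (n∣[1+k]*nC[1+k] (p ^ n) k)

    p∣p^[1+v]Ck : ∀ v {k} → 0 < k → k < p ^ suc v → p ∣ p ^ suc v C k
    p∣p^[1+v]Ck v {k} 0<k k<p^[1+v] = subst (_∣ p ^ suc v C k) (*-identityʳ p)
      (subst (λ e → p ^ e ∣ p ^ suc v C k) (m+n∸n≡m 1 v) (p^[n∸v]∣p^nCk (suc v) v 0<k k<p^[1+v]))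

module PowerBounds where

  open import Data.Nat
  open import Data.Nat.Properties
  open import Data.Nat.DivMod using (m/n*n≤m)
  open import Relation.Binary.PropositionalEquality

  n/2+n/2≤n : ∀ n → n / 2 + n / 2 ≤ n
  n/2+n/2≤n n = subst (_≤ n) (trans (*-comm (n / 2) 2) (cong (n / 2 +_) (+-identityʳ (n / 2)))) (m/n*n≤m n 2)

  n/2≤n∸n/2 : ∀ n → n / 2 ≤ n ∸ n / 2
  n/2≤n∸n/2 n = m+n≤o⇒m≤o∸n (n / 2) (n/2+n/2≤n n)

  module _ {p : ℕ} (2≤p : 2 ≤ p) where
    private instance _ = >-nonZero (≤-trans (s≤s z≤n) 2≤p)

    1+m≤p^m : ∀ m → suc m ≤ p ^ m
    1+m≤p^m zero    = ≤-refl
    1+m≤p^m (suc m) = begin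
      suc (suc m)        ≤⟨ s≤s (1+m≤p^m m) ⟩
      suc (p ^ m)        ≤⟨ +-monoˡ-≤ (p ^ m) (m^n>0 p m) ⟩
      p ^ m + p ^ m      ≡⟨ cong (p ^ m +_) (+-identityʳ (p ^ m)) ⟨
      2 * p ^ m          ≤⟨ *-monoˡ-≤ (p ^ m) 2≤p ⟩
      p * p ^ m          ∎
      where open ≤-Reasoning

    m*p^[1+m]≤p^[m+m] : ∀ m → m * p ^ suc m ≤ p ^ (m + m)
    m*p^[1+m]≤p^[m+m] zero    = z≤n
    m*p^[1+m]≤p^[m+m] (suc m) = begin
      suc m * p ^ (2 + m)  ≤⟨ *-monoˡ-≤ (p ^ (2 + m)) (1+m≤p^m m) ⟩
      p ^ m * p ^ (2 + m)  ≡⟨ ^-distribˡ-+-* p m (2 + m) ⟨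
      p ^ (m + (2 + m))    ≡⟨ cong (p ^_) (+-suc m (suc m)) ⟩
      p ^ (suc m + suc m)  ∎
      where open ≤-Reasoning

module _ {c ℓ : Level} (S : CommutativeSemiring c ℓ) where

  open CommutativeSemiring S
  open import Algebra.Definitions.RawSemiring rawSemiring using (_^_)
  open import Algebra.Solver.Ring.NaturalCoefficients.Default S
  open import Data.Nat using (zero; suc)
  open import Relation.Binary.Reasoning.Setoid setoid

  x≈w+y*z⇒x^j≈a*w+b*y^j : ∀ {x w y z} → x ≈ w + y * z → ∀ j →
    ∃₂ λ a b → x ^ j ≈ a * w + b * y ^ j
  x≈w+y*z⇒x^j≈a*w+b*y^j {x} {w} {y} {z} x≈ zero =
    0# , 1# , sym (trans (+-cong (zeroˡ w) (*-identityˡ 1#)) (+-identityˡ 1#))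
  x≈w+y*z⇒x^j≈a*w+b*y^j {x} {w} {y} {z} x≈ (suc j) with x≈w+y*z⇒x^j≈a*w+b*y^j x≈ j
  ... | a , b , x^j≈ = x * a + b * y ^ j , b * z , (begin
    x * x ^ j                             ≈⟨ *-congˡ x^j≈ ⟩
    x * (a * w + b * y ^ j)               ≈⟨ solve 5 (λ x w a b yʲ → x :* (a :* w :+ b :* yʲ) := x :* (a :* w) :+ (b :* yʲ) :* x) refl x w a b (y ^ j) ⟩
    x * (a * w) + (b * y ^ j) * x         ≈⟨ +-congˡ (*-congˡ x≈) ⟩
    x * (a * w) + (b * y ^ j) * (w + y * z)
      ≈⟨ solve 7 (λ x w a b yʲ y z → x :* (a :* w) :+ (b :* yʲ) :* (w :+ y :* z) := (x :* a :+ b :* yʲ) :* w :+ (b :* z) :* (y :* yʲ)) refl x w a b (y ^ j) y z ⟩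
    (x * a + b * y ^ j) * w + (b * z) * (y * y ^ j) ∎)

module PowerSeriesRing {c ℓ : Level} (R : CommutativeRing c ℓ) where

  open PowerSeries R public
  open CommutativeRing R renaming (Carrier to A) hiding (zero)
  open import Algebra.Properties.CommutativeSemigroup +-commutativeSemigroup using (interchange)
  open import Data.Nat as ℕ using (ℕ; zero; suc; _∸_; z≤n)
  import Data.Nat.Divisibility as ℕ
  open import Data.Nat.Properties as ℕ using (m≤n⇒m≤1+n; ≤-refl; m∸[m∸n]≡n; m+[n∸m]≡n)
  open import Algebra.Properties.Ring ring using (-0#≈0#)
  open import Relation.Nullary using (Dec; yes; no)
  open import Relation.Binary.PropositionalEquality as ≡ using (_≡_)
  open import Relation.Binary.Reasoning.Setoid setoid
  open import Algebra.Definitions.RawSemiring (Semiring.rawSemiring semiring) using (_×_)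
  open import Algebra.Properties.Semiring.Divisibility semiring using (_∣_; _∣ʳ_; _,_; _∣0; ∣ʳ-respʳ-≈)
  open import Algebra.Properties.Semiring.Mult semiring using (×-homo-+; ×1-homo-*)
  open import Data.Nat.Combinatorics using (nCk+nC[k+1]≡[n+1]C[k+1]) renaming (_C_ to _choose_)

  sumTo-cong : ∀ k {h h′ : ℕ → A} → (∀ i → i ℕ.≤ k → h i ≈ h′ i) → sumTo k h ≈ sumTo k h′
  sumTo-cong zero    h≈h′ = h≈h′ 0 z≤n
  sumTo-cong (suc k) h≈h′ =
    +-cong (sumTo-cong k (λ i i≤k → h≈h′ i (m≤n⇒m≤1+n i≤k))) (h≈h′ (suc k) ≤-refl)

  sumTo-distrib-+ : ∀ k (h h′ : ℕ → A) → sumTo k (λ i → h i + h′ i) ≈ sumTo k h + sumTo k h′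
  sumTo-distrib-+ zero    h h′ = refl
  sumTo-distrib-+ (suc k) h h′ = trans (+-congʳ (sumTo-distrib-+ k h h′)) (interchange _ _ _ _)

  sumTo-head : ∀ k {h : ℕ → A} → (∀ i → h (suc i) ≈ 0#) → sumTo k h ≈ h 0
  sumTo-head zero    _    = refl
  sumTo-head (suc k) h≈0 = trans (+-cong (sumTo-head k h≈0) (h≈0 k)) (+-identityʳ _)

  *-distribˡ-sumTo : ∀ k a (h : ℕ → A) → a * sumTo k h ≈ sumTo k (λ i → a * h i)
  *-distribˡ-sumTo zero    a h = refl
  *-distribˡ-sumTo (suc k) a h = trans (distribˡ a _ _) (+-congʳ (*-distribˡ-sumTo k a h))

  *-distribʳ-sumTo : ∀ k a (h : ℕ → A) → sumTo k h * a ≈ sumTo k (λ i → h i * a)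
  *-distribʳ-sumTo zero    a h = refl
  *-distribʳ-sumTo (suc k) a h = trans (distribʳ a _ _) (+-congʳ (*-distribʳ-sumTo k a h))

  sumTo-suc : ∀ k (h : ℕ → A) → sumTo (suc k) h ≈ h 0 + sumTo k (λ i → h (suc i))
  sumTo-suc zero    h = refl
  sumTo-suc (suc k) h = trans (+-congʳ (sumTo-suc k h)) (+-assoc _ _ _)

  sumTo-reverse : ∀ k (h : ℕ → A) → sumTo k h ≈ sumTo k (λ i → h (k ∸ i))
  sumTo-reverse zero    h = refl
  sumTo-reverse (suc k) h = begin
    sumTo k h + h (suc k)                  ≈⟨ +-congʳ (sumTo-reverse k h) ⟩
    sumTo k (λ i → h (k ∸ i)) + h (suc k)  ≈⟨ +-comm _ _ ⟩
    h (suc k) + sumTo k (λ i → h (k ∸ i))  ≈⟨ sumTo-suc k (λ i → h (suc k ∸ i)) ⟨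
    sumTo (suc k) (λ i → h (suc k ∸ i))    ∎

  sumAntidiagonal : ℕ → (ℕ → ℕ → A) → A
  sumAntidiagonal k F = sumTo k (λ i → F i (k ∸ i))

  sumAntidiagonal-suc : ∀ k F →
    sumAntidiagonal (suc k) F ≈ F 0 (suc k) + sumAntidiagonal k (λ a b → F (suc a) b)
  sumAntidiagonal-suc k F = sumTo-suc k (λ i → F i (suc k ∸ i))

  sumAntidiagonal-cong : ∀ k {F G : ℕ → ℕ → A} → (∀ a b → F a b ≈ G a b) →
    sumAntidiagonal k F ≈ sumAntidiagonal k G
  sumAntidiagonal-cong k F≈G = sumTo-cong k (λ i _ → F≈G i (k ∸ i))

  -- Both sides are the sum of G a b c over a + b + c = k.
  sumAntidiagonal-assoc : ∀ k (G : ℕ → ℕ → ℕ → A) →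
    sumAntidiagonal k (λ i c → sumAntidiagonal i (λ a b → G a b c))
      ≈ sumAntidiagonal k (λ a r → sumAntidiagonal r (λ b c → G a b c))
  sumAntidiagonal-assoc zero    G = refl
  sumAntidiagonal-assoc (suc k) G = begin
    S (suc k) (λ i c → S i (λ a b → G a b c))
      ≈⟨ S-suc k (λ i c → S i (λ a b → G a b c)) ⟩
    G 0 0 (suc k) + sumTo k (λ i → S (suc i) (λ a b → G a b (k ∸ i)))
      ≈⟨ +-congˡ (sumTo-cong k (λ i _ → S-suc i (λ a b → G a b (k ∸ i)))) ⟩
    G 0 0 (suc k) + sumTo k (λ i → G 0 (suc i) (k ∸ i) + S i (λ a b → G (suc a) b (k ∸ i)))
      ≈⟨ +-congˡ (sumTo-distrib-+ k _ _) ⟩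
    G 0 0 (suc k) + (S k (λ b c → G 0 (suc b) c) + S k (λ i c → S i (λ a b → G (suc a) b c)))
      ≈⟨ +-congˡ (+-congˡ (sumAntidiagonal-assoc k (λ a → G (suc a)))) ⟩
    G 0 0 (suc k) + (S k (λ b c → G 0 (suc b) c) + S k (λ a r → S r (λ b c → G (suc a) b c)))
      ≈⟨ +-assoc _ _ _ ⟨
    (G 0 0 (suc k) + S k (λ b c → G 0 (suc b) c)) + S k (λ a r → S r (λ b c → G (suc a) b c))
      ≈⟨ +-congʳ (S-suc k (G 0)) ⟨
    S (suc k) (G 0) + S k (λ a r → S r (λ b c → G (suc a) b c))
      ≈⟨ S-suc k (λ a r → S r (λ b c → G a b c)) ⟨
    S (suc k) (λ a r → S r (λ b c → G a b c)) ∎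
    where
    S = sumAntidiagonal
    S-suc = sumAntidiagonal-suc

  *ₚ-cong : ∀ {f f′ g g′} → f ≈ₚ f′ → g ≈ₚ g′ → f *ₚ g ≈ₚ f′ *ₚ g′
  *ₚ-cong f≈f′ g≈g′ k = sumTo-cong k (λ i _ → *-cong (f≈f′ i) (g≈g′ (k ∸ i)))

  *ₚ-comm : ∀ f g → f *ₚ g ≈ₚ g *ₚ f
  *ₚ-comm f g k = trans (sumTo-reverse k _) (sumTo-cong k λ i i≤k →
    trans (*-comm _ _) (*-congʳ (reflexive (≡.cong g (m∸[m∸n]≡n i≤k)))))

  *ₚ-assoc : ∀ f g h → (f *ₚ g) *ₚ h ≈ₚ f *ₚ (g *ₚ h)
  *ₚ-assoc f g h k = begin
    S k (λ i c → S i (λ a b → f a * g b) * h c)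
      ≈⟨ sumTo-cong k (λ i _ → *-distribʳ-sumTo i (h (k ∸ i)) _) ⟩
    S k (λ i c → S i (λ a b → (f a * g b) * h c))
      ≈⟨ sumAntidiagonal-assoc k (λ a b c → (f a * g b) * h c) ⟩
    S k (λ a r → S r (λ b c → (f a * g b) * h c))
      ≈⟨ sumAntidiagonal-cong k (λ a r → sumAntidiagonal-cong r (λ b c → *-assoc (f a) (g b) (h c))) ⟩
    S k (λ a r → S r (λ b c → f a * (g b * h c)))
      ≈⟨ sumTo-cong k (λ i _ → *-distribˡ-sumTo (k ∸ i) (f i) _) ⟨
    S k (λ a r → f a * S r (λ b c → g b * h c)) ∎
    where S = sumAntidiagonal

  C*ₚ-coeff : ∀ a f k → (C a *ₚ f) k ≈ a * f k
  C*ₚ-coeff a f k = sumTo-head k (λ i → zeroˡ _)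

  *ₚ-identityˡ : ∀ f → 𝟙ₚ *ₚ f ≈ₚ f
  *ₚ-identityˡ f k = trans (C*ₚ-coeff 1# f k) (*-identityˡ (f k))

  *ₚ-distribˡ : ∀ f g h → f *ₚ (g +ₚ h) ≈ₚ f *ₚ g +ₚ f *ₚ h
  *ₚ-distribˡ f g h k = trans (sumTo-cong k (λ i _ → distribˡ _ _ _)) (sumTo-distrib-+ k _ _)

  𝟘ₚ-coeff : ∀ k → 𝟘ₚ k ≈ 0#
  𝟘ₚ-coeff zero    = refl
  𝟘ₚ-coeff (suc k) = refl

  Λ : CommutativeRing c ℓ
  Λ = record
    { Carrier = PS ; _≈_ = _≈ₚ_ ; _+_ = _+ₚ_ ; _*_ = _*ₚ_ ; -_ = λ f k → - f k ; 0# = 𝟘ₚ ; 1# = 𝟙ₚ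
    ; isCommutativeRing = record
      { isRing = record
        { +-isAbelianGroup = record
          { isGroup = record
            { isMonoid = record
              { isSemigroup = record
                { isMagma = record
                  { isEquivalence = record
                    { refl = λ k → refl ; sym = λ f≈g k → sym (f≈g k) ; trans = λ f≈g g≈h k → trans (f≈g k) (g≈h k) }
                  ; ∙-cong = λ f≈f′ g≈g′ k → +-cong (f≈f′ k) (g≈g′ k) }
                ; assoc = λ f g h k → +-assoc _ _ _ }
              ; identity = (λ f k → trans (+-congʳ (𝟘ₚ-coeff k)) (+-identityˡ _))
                         , (λ f k → trans (+-congˡ (𝟘ₚ-coeff k)) (+-identityʳ _)) }
            ; inverse = (λ f k → trans (-‿inverseˡ _) (sym (𝟘ₚ-coeff k)))
                      , (λ f k → trans (-‿inverseʳ _) (sym (𝟘ₚ-coeff k)))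
            ; ⁻¹-cong = λ f≈g k → -‿cong (f≈g k) }
          ; comm = λ f g k → +-comm _ _ }
        ; *-cong = *ₚ-cong
        ; *-assoc = *ₚ-assoc
        ; *-identity = *ₚ-identityˡ , (λ f k → trans (*ₚ-comm f 𝟙ₚ k) (*ₚ-identityˡ f k))
        ; distrib = *ₚ-distribˡ
                  , (λ f g h k → trans (*ₚ-comm (g +ₚ h) f k)
                                  (trans (*ₚ-distribˡ f g h k) (+-cong (*ₚ-comm f g k) (*ₚ-comm f h k)))) }
      ; *-comm = *ₚ-comm } }

  module Λ = CommutativeRing Λ

  ^ₚ-homo-+ : ∀ f i j → f ^ₚ (i ℕ.+ j) ≈ₚ f ^ₚ i *ₚ f ^ₚ j
  ^ₚ-homo-+ f zero    j = Λ.sym (*ₚ-identityˡ (f ^ₚ j))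
  ^ₚ-homo-+ f (suc i) j = Λ.trans (Λ.*-congˡ (^ₚ-homo-+ f i j)) (Λ.sym (Λ.*-assoc f (f ^ₚ i) (f ^ₚ j)))

  ^ₚ-* : ∀ f m n → f ^ₚ (m ℕ.* n) ≈ₚ (f ^ₚ n) ^ₚ m
  ^ₚ-* f zero    n = Λ.refl
  ^ₚ-* f (suc m) n = Λ.trans (^ₚ-homo-+ f n (m ℕ.* n)) (Λ.*-congˡ (^ₚ-* f m n))

  open import Algebra.Definitions.RawSemiring (Semiring.rawSemiring Λ.semiring) using (_^_)

  ^ₚ≈^ : ∀ f m → f ^ₚ m ≈ₚ f ^ m
  ^ₚ≈^ f zero    = Λ.refl
  ^ₚ≈^ f (suc m) = Λ.*-congˡ (^ₚ≈^ f m)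

  T*ₚ-coeff-zero : ∀ f → (T *ₚ f) 0 ≈ 0#
  T*ₚ-coeff-zero f = zeroˡ _

  T*ₚ-coeff-suc : ∀ f k → (T *ₚ f) (suc k) ≈ f k
  T*ₚ-coeff-suc f k = begin
    sumTo (suc k) (λ i → T i * f (suc k ∸ i))              ≈⟨ sumTo-suc k _ ⟩
    0# * f (suc k) + sumTo k (λ i → T (suc i) * f (k ∸ i)) ≈⟨ +-cong (zeroˡ _) (sumTo-head k (λ i → zeroˡ _)) ⟩
    0# + 1# * f k                                          ≈⟨ +-identityˡ _ ⟩
    1# * f k                                               ≈⟨ *-identityˡ _ ⟩
    f k                                                    ∎

  T^ₚ*ₚ-coeff-< : ∀ M f k → k ℕ.< M → (T ^ₚ M *ₚ f) k ≈ 0#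
  T^ₚ*ₚ-coeff-< (suc M) f zero    _ = trans (*ₚ-assoc T (T ^ₚ M) f 0) (T*ₚ-coeff-zero (T ^ₚ M *ₚ f))
  T^ₚ*ₚ-coeff-< (suc M) f (suc k) (ℕ.s≤s k<M) =
    trans (*ₚ-assoc T (T ^ₚ M) f (suc k)) (trans (T*ₚ-coeff-suc (T ^ₚ M *ₚ f) k) (T^ₚ*ₚ-coeff-< M f k k<M))

  T^ₚ*ₚ-coeff-+ : ∀ M f j → (T ^ₚ M *ₚ f) (M ℕ.+ j) ≈ f j
  T^ₚ*ₚ-coeff-+ zero    f j = *ₚ-identityˡ f j
  T^ₚ*ₚ-coeff-+ (suc M) f j =
    trans (*ₚ-assoc T (T ^ₚ M) f (suc M ℕ.+ j)) (trans (T*ₚ-coeff-suc (T ^ₚ M *ₚ f) (M ℕ.+ j)) (T^ₚ*ₚ-coeff-+ M f j))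

  natR≡×1# : ∀ n → natR n ≡ n × 1#
  natR≡×1# zero    = ≡.refl
  natR≡×1# (suc n) = ≡.cong (1# +_) (natR≡×1# n)

  natR-homo-+ : ∀ m n → natR (m ℕ.+ n) ≈ natR m + natR n
  natR-homo-+ m n rewrite natR≡×1# (m ℕ.+ n) | natR≡×1# m | natR≡×1# n = ×-homo-+ 1# m n

  natR-homo-* : ∀ m n → natR (m ℕ.* n) ≈ natR m * natR n
  natR-homo-* m n rewrite natR≡×1# (m ℕ.* n) | natR≡×1# m | natR≡×1# n = ×1-homo-* m n

  natR-mono-∣ : ∀ {d n} → d ℕ.∣ n → natR d ∣ natR n
  natR-mono-∣ {d} (ℕ.divides q ≡.refl) = natR q , sym (natR-homo-* q d)

  C-cong : ∀ {a b} → a ≈ b → C a ≈ₚ C b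
  C-cong a≈b zero    = a≈b
  C-cong a≈b (suc k) = refl

  C-homo-* : ∀ a b → C a *ₚ C b ≈ₚ C (a * b)
  C-homo-* a b zero    = C*ₚ-coeff a (C b) zero
  C-homo-* a b (suc k) = trans (C*ₚ-coeff a (C b) (suc k)) (zeroʳ a)

  C[natR]^ₚ : ∀ q m → C (natR q) ^ₚ m ≈ₚ C (natR (q ℕ.^ m))
  C[natR]^ₚ q zero    = C-cong (sym (+-identityʳ 1#))
  C[natR]^ₚ q (suc m) = Λ.trans (Λ.*-congˡ (C[natR]^ₚ q m))
    (Λ.trans (C-homo-* _ _) (C-cong (sym (natR-homo-* q (q ℕ.^ m)))))

  [𝟙+T]^ₚ-coeff : ∀ N k → ((𝟙ₚ +ₚ T) ^ₚ N) k ≈ natR (N choose k)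
  [𝟙+T]^ₚ-coeff zero    zero    = sym (+-identityʳ 1#)
  [𝟙+T]^ₚ-coeff zero    (suc k) = refl
  [𝟙+T]^ₚ-coeff (suc N) k = trans (Λ.distribʳ P 𝟙ₚ T k) (trans (+-congʳ (*ₚ-identityˡ P k)) (pascal k))
    where
    P = (𝟙ₚ +ₚ T) ^ₚ N
    pascal : ∀ k → P k + (T *ₚ P) k ≈ natR (suc N choose k)
    pascal zero    = trans (+-cong ([𝟙+T]^ₚ-coeff N 0) (T*ₚ-coeff-zero P)) (+-identityʳ _)
    pascal (suc k) = begin
      P (suc k) + (T *ₚ P) (suc k)
        ≈⟨ +-cong ([𝟙+T]^ₚ-coeff N (suc k)) (trans (T*ₚ-coeff-suc P k) ([𝟙+T]^ₚ-coeff N k)) ⟩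
      natR (N choose suc k) + natR (N choose k)    ≈⟨ +-comm _ _ ⟩
      natR (N choose k) + natR (N choose suc k)    ≈⟨ natR-homo-+ (N choose k) (N choose suc k) ⟨
      natR (N choose k ℕ.+ N choose suc k)         ≡⟨ ≡.cong natR (nCk+nC[k+1]≡[n+1]C[k+1] N k) ⟩
      natR (suc N choose suc k)               ∎

  ω-coeff-zero : ∀ p n → ω p n 0 ≈ 0#
  ω-coeff-zero p n = trans (+-congʳ (trans ([𝟙+T]^ₚ-coeff (p ℕ.^ n) 0) (+-identityʳ 1#))) (-‿inverseʳ 1#)

  ω-coeff : ∀ p n {k} → 0 ℕ.< k → ω p n k ≈ natR (p ℕ.^ n choose k)
  ω-coeff p n {suc k} _ = trans (+-cong ([𝟙+T]^ₚ-coeff (p ℕ.^ n) (suc k)) -0#≈0#) (+-identityʳ _)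

  dropₚ : ℕ → PS → PS
  dropₚ M f j = f (M ℕ.+ j)

  ∣-below⇒≈C*ₚ+T^ₚ*ₚdropₚ : ∀ M c f → (∀ k → k ℕ.< M → c ∣ f k) →
    Σ PS λ g → f ≈ₚ C c *ₚ g +ₚ T ^ₚ M *ₚ dropₚ M f
  ∣-below⇒≈C*ₚ+T^ₚ*ₚdropₚ M c f c∣f = g , λ k → trans (split k) (+-congʳ (sym (C*ₚ-coeff c g k)))
    where
    quotientBelow : ∀ k → Dec (k ℕ.< M) → A
    quotientBelow k (yes k<M) = _∣ʳ_.quotient (c∣f k k<M)
    quotientBelow k (no _)    = 0#
    g : PS
    g k = quotientBelow k (k ℕ.<? M)
    split : ∀ k → f k ≈ c * g k + (T ^ₚ M *ₚ dropₚ M f) k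
    split k with k ℕ.<? M
    ... | yes k<M = begin
      f k                              ≈⟨ _∣ʳ_.equality (c∣f k k<M) ⟨
      q * c                            ≈⟨ *-comm q c ⟩
      c * q                            ≈⟨ +-identityʳ _ ⟨
      c * q + 0#                       ≈⟨ +-congˡ (T^ₚ*ₚ-coeff-< M (dropₚ M f) k k<M) ⟨
      c * q + (T ^ₚ M *ₚ dropₚ M f) k  ∎
      where q = _∣ʳ_.quotient (c∣f k k<M)
    ... | no k≮M = begin
      f k                                   ≡⟨ ≡.cong f (m+[n∸m]≡n M≤k) ⟨
      f (M ℕ.+ (k ∸ M))                     ≈⟨ T^ₚ*ₚ-coeff-+ M (dropₚ M f) (k ∸ M) ⟨
      (T ^ₚ M *ₚ dropₚ M f) (M ℕ.+ (k ∸ M)) ≡⟨ ≡.cong (T ^ₚ M *ₚ dropₚ M f) (m+[n∸m]≡n M≤k) ⟩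
      (T ^ₚ M *ₚ dropₚ M f) k               ≈⟨ +-identityˡ _ ⟨
      0# + (T ^ₚ M *ₚ dropₚ M f) k          ≈⟨ +-congʳ (zeroʳ c) ⟨
      c * 0# + (T ^ₚ M *ₚ dropₚ M f) k      ∎
      where M≤k = ℕ.≮⇒≥ k≮M

module Ideals {c ℓ : Level} (R : CommutativeRing c ℓ) where

  open PowerSeriesRing R using (PS; 𝟘ₚ; 𝟙ₚ; ΣFin; _∈⟨_⟩; _⊆⟨⟩_; ⟨_,_⟩; 𝟘ₚ-coeff; Λ)
  open CommutativeRing Λ hiding (zero)
  open import Algebra.Properties.Semiring.Sum semiring using (sum; ∑-comm; *-distribˡ-sum; *-distribʳ-sum; sum-cong-≋)
  open import Data.Nat using (zero; suc)
  open import Data.Fin using (Fin; zero; suc)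
  open import Data.Vec.Functional using (_∷_)
  open import Function using (_∘_)
  open import Relation.Binary.Reasoning.Setoid setoid
  private module R = CommutativeRing R

  ΣFin≈sum : ∀ {m} (u : Fin m → PS) → ΣFin u ≈ sum u
  ΣFin≈sum {zero}  u k = R.sym (𝟘ₚ-coeff k)
  ΣFin≈sum {suc m} u k = R.+-congˡ (ΣFin≈sum (u ∘ suc) k)

  ΣFin-𝟘ₚ*ₚ : ∀ {m} (g : Fin m → PS) → ΣFin (λ j → 𝟘ₚ * g j) ≈ 𝟘ₚ
  ΣFin-𝟘ₚ*ₚ {zero}  g k = R.sym (𝟘ₚ-coeff k)
  ΣFin-𝟘ₚ*ₚ {suc m} g k = R.trans (R.+-cong (zeroˡ (g zero) k) (ΣFin-𝟘ₚ*ₚ (g ∘ suc) k)) (+-identityˡ 𝟘ₚ k)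

  ∈⟨⟩-resp-≈ : ∀ {m} {g : Fin m → PS} {x y} → x ≈ y → y ∈⟨ g ⟩ → x ∈⟨ g ⟩
  ∈⟨⟩-resp-≈ x≈y (u , y≈) = u , trans x≈y y≈

  ∈⟨,⟩-intro : ∀ {x a b} u v → x ≈ u * a + v * b → x ∈⟨ ⟨ a , b ⟩ ⟩
  ∈⟨,⟩-intro u v x≈ = ⟨ u , v ⟩ , λ k → R.trans (x≈ k) (R.+-congˡ (R.sym (R.+-identityʳ _)))

  generator∈⟨⟩ : ∀ {m} (g : Fin m → PS) i → g i ∈⟨ g ⟩
  generator∈⟨⟩ g zero    = 𝟙ₚ ∷ (λ _ → 𝟘ₚ) , λ k →
    R.sym (R.trans (R.+-cong (*-identityˡ (g zero) k) (ΣFin-𝟘ₚ*ₚ (g ∘ suc) k)) (+-identityʳ (g zero) k))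
  generator∈⟨⟩ g (suc i) with generator∈⟨⟩ (g ∘ suc) i
  ... | u , g[1+i]≈ = 𝟘ₚ ∷ u , λ k →
    R.trans (g[1+i]≈ k) (R.sym (R.trans (R.+-congʳ (zeroˡ (g zero) k)) (+-identityˡ (ΣFin (λ j → u j * g (suc j))) k)))

  ⊆⟨⟩-intro : ∀ {m m′} {g : Fin m → PS} {h : Fin m′ → PS} → (∀ i → g i ∈⟨ h ⟩) → g ⊆⟨⟩ h
  ⊆⟨⟩-intro {g = g} {h} g∈h x (u , x≈) = w , (begin
    x                                           ≈⟨ x≈ ⟩
    ΣFin (λ i → u i * g i)                      ≈⟨ ΣFin≈sum (λ i → u i * g i) ⟩
    sum (λ i → u i * g i)                       ≈⟨ sum-cong-≋ (λ i → *-congˡ (trans (proj₂ (g∈h i)) (ΣFin≈sum (λ j → v i j * h j)))) ⟩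
    sum (λ i → u i * sum (λ j → v i j * h j))   ≈⟨ sum-cong-≋ (λ i → *-distribˡ-sum (u i) (λ j → v i j * h j)) ⟩
    sum (λ i → sum (λ j → u i * (v i j * h j))) ≈⟨ ∑-comm (λ i j → u i * (v i j * h j)) ⟩
    sum (λ j → sum (λ i → u i * (v i j * h j))) ≈⟨ sum-cong-≋ (λ j → sum-cong-≋ (λ i → *-assoc (u i) (v i j) (h j))) ⟨
    sum (λ j → sum (λ i → u i * v i j * h j))   ≈⟨ sum-cong-≋ (λ j → *-distribʳ-sum (h j) (λ i → u i * v i j)) ⟨
    sum (λ j → w j * h j)                       ≈⟨ ΣFin≈sum (λ j → w j * h j) ⟨
    ΣFin (λ j → w j * h j)                      ∎)
    where
    v : Fin _ → Fin _ → PS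
    v i = proj₁ (g∈h i)
    w : Fin _ → PS
    w j = sum (λ i → u i * v i j)

  ∈⟨⟩-*ˡ : ∀ {m} {g : Fin m → PS} {y} u → y ∈⟨ g ⟩ → (u * y) ∈⟨ g ⟩
  ∈⟨⟩-*ˡ {g = g} {y} u (v , y≈) = (λ i → u * v i) , (begin
    u * y                        ≈⟨ *-congˡ (trans y≈ (ΣFin≈sum (λ i → v i * g i))) ⟩
    u * sum (λ i → v i * g i)    ≈⟨ *-distribˡ-sum u (λ i → v i * g i) ⟩
    sum (λ i → u * (v i * g i))  ≈⟨ sum-cong-≋ (λ i → *-assoc u (v i) (g i)) ⟨
    sum (λ i → u * v i * g i)    ≈⟨ ΣFin≈sum (λ i → u * v i * g i) ⟨
    ΣFin (λ i → u * v i * g i)   ∎)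

  multiple∈⟨⟩ : ∀ {m} (g : Fin m → PS) {x} u i → x ≈ u * g i → x ∈⟨ g ⟩
  multiple∈⟨⟩ g u i x≈ = ∈⟨⟩-resp-≈ {g = g} x≈ (∈⟨⟩-*ˡ {g = g} u (generator∈⟨⟩ g i))

module IdealMemberships {c ℓ : Level} (R : CommutativeRing c ℓ) where

  open PowerSeriesRing R
  open Ideals R
  open import Algebra.Properties.CommutativeSemigroup Λ.*-commutativeSemigroup using (xy∙z≈xz∙y)
  open import Algebra.Definitions.RawSemiring (Semiring.rawSemiring Λ.semiring) using (_^_)
  open import Algebra.Properties.Semiring.Divisibility (CommutativeRing.semiring R) using (_∣_; _∣0; ∣ʳ-respʳ-≈)
  open import Data.Nat as ℕ using (ℕ; zero; suc; _∸_; z<s)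
  open import Data.Nat.Properties using (m∸n+n≡m; +-identityʳ; +-∸-comm; <⇒≤; ≰⇒>; n∸n≡0; <-≤-trans; m^n>0; m≤m+n; m<m+n)
  open import Data.Fin.Properties using (toℕ-fromℕ)
  open import Data.Nat.Divisibility using (∣-trans)
  open import Data.Nat.Combinatorics using (nCn≡1; k>n⇒nCk≡0) renaming (_C_ to _choose_)
  open import Data.Nat.Primality using (Prime; prime⇒nonZero)
  open import Data.Fin using (zero; suc; toℕ; fromℕ)
  open import Relation.Nullary using (yes; no)
  open import Relation.Binary.PropositionalEquality as ≡ using (_≡_)
  open import Relation.Binary.Reasoning.Setoid Λ.setoid
  open BinomialDivisibility
  private module R = CommutativeRing R

  maxPow[2n]⊆⟨πⁿ,Tⁿ⟩ : ∀ π n → maxPow π (2 ℕ.* n) ⊆⟨⟩ ⟨ C π ^ₚ n , T ^ₚ n ⟩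
  maxPow[2n]⊆⟨πⁿ,Tⁿ⟩ π n = ⊆⟨⟩-intro {g = maxPow π (2 ℕ.* n)} {h = ⟨ C π ^ₚ n , T ^ₚ n ⟩} (λ i → πᵗT²ⁿ⁻ᵗ∈ (toℕ i))
    where
    πᵗT²ⁿ⁻ᵗ∈ : ∀ t → (C π ^ₚ t *ₚ T ^ₚ (2 ℕ.* n ∸ t)) ∈⟨ ⟨ C π ^ₚ n , T ^ₚ n ⟩ ⟩
    πᵗT²ⁿ⁻ᵗ∈ t with n ℕ.≤? t
    ... | yes n≤t = multiple∈⟨⟩ ⟨ C π ^ₚ n , T ^ₚ n ⟩ (C π ^ₚ (t ∸ n) *ₚ T ^ₚ r) zero (begin
      C π ^ₚ t *ₚ T ^ₚ r                    ≡⟨ ≡.cong (λ e → C π ^ₚ e *ₚ T ^ₚ r) (m∸n+n≡m n≤t) ⟨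
      C π ^ₚ (t ∸ n ℕ.+ n) *ₚ T ^ₚ r        ≈⟨ Λ.*-congʳ {T ^ₚ r} (^ₚ-homo-+ (C π) (t ∸ n) n) ⟩
      C π ^ₚ (t ∸ n) *ₚ C π ^ₚ n *ₚ T ^ₚ r  ≈⟨ xy∙z≈xz∙y (C π ^ₚ (t ∸ n)) (C π ^ₚ n) (T ^ₚ r) ⟩
      C π ^ₚ (t ∸ n) *ₚ T ^ₚ r *ₚ C π ^ₚ n  ∎)
      where r = 2 ℕ.* n ∸ t
    ... | no n≰t = multiple∈⟨⟩ ⟨ C π ^ₚ n , T ^ₚ n ⟩ (C π ^ₚ t *ₚ T ^ₚ (n ∸ t)) (suc zero) (begin
      C π ^ₚ t *ₚ T ^ₚ (2 ℕ.* n ∸ t)        ≡⟨ ≡.cong (λ e → C π ^ₚ t *ₚ T ^ₚ e) 2n∸t≡[n∸t]+n ⟩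
      C π ^ₚ t *ₚ T ^ₚ (n ∸ t ℕ.+ n)        ≈⟨ Λ.*-congˡ (^ₚ-homo-+ T (n ∸ t) n) ⟩
      C π ^ₚ t *ₚ (T ^ₚ (n ∸ t) *ₚ T ^ₚ n)  ≈⟨ Λ.*-assoc (C π ^ₚ t) (T ^ₚ (n ∸ t)) (T ^ₚ n) ⟨
      C π ^ₚ t *ₚ T ^ₚ (n ∸ t) *ₚ T ^ₚ n    ∎)
      where
      2n∸t≡[n∸t]+n : 2 ℕ.* n ∸ t ≡ n ∸ t ℕ.+ n
      2n∸t≡[n∸t]+n = ≡.trans (≡.cong (λ e → n ℕ.+ e ∸ t) (+-identityʳ n)) (+-∸-comm n (<⇒≤ (≰⇒> n≰t)))

  ⟨πⁿ,Tⁿ⟩⊆maxPow[n] : ∀ π n → ⟨ C π ^ₚ n , T ^ₚ n ⟩ ⊆⟨⟩ maxPow π n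
  ⟨πⁿ,Tⁿ⟩⊆maxPow[n] π n = ⊆⟨⟩-intro {g = ⟨ C π ^ₚ n , T ^ₚ n ⟩} {h = maxPow π n} λ
    { zero       → multiple∈⟨⟩ (maxPow π n) 𝟙ₚ (fromℕ n) πⁿ≈
    ; (suc zero) → multiple∈⟨⟩ (maxPow π n) 𝟙ₚ zero (Λ.sym (Λ.trans (*ₚ-identityˡ _) (*ₚ-identityˡ (T ^ₚ n)))) }
    where
    maxPow-last : maxPow π n (fromℕ n) ≡ C π ^ₚ n *ₚ T ^ₚ 0
    maxPow-last rewrite toℕ-fromℕ n | n∸n≡0 n = ≡.refl
    πⁿ≈ : C π ^ₚ n ≈ₚ 𝟙ₚ *ₚ maxPow π n (fromℕ n)
    πⁿ≈ = Λ.sym (Λ.trans (*ₚ-identityˡ _) (Λ.trans (Λ.reflexive maxPow-last) (Λ.*-identityʳ (C π ^ₚ n))))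

  module _ {p : ℕ} (p-prime : Prime p) where
    private instance _ = prime⇒nonZero p-prime

    ω∈⟨pᵐ,T^p^[1+m]⟩ : ∀ n m → m ℕ.≤ n ∸ m → ω p n ∈⟨ ⟨ C (natR p) ^ₚ m , T ^ₚ (p ℕ.^ suc m) ⟩ ⟩
    ω∈⟨pᵐ,T^p^[1+m]⟩ n m m≤n∸m = ∈⟨,⟩-intro {a = C (natR p) ^ₚ m} {T ^ₚ M} g (dropₚ M (ω p n)) (begin
      ω p n                                                ≈⟨ ω≈ ⟩
      C (natR (p ℕ.^ m)) *ₚ g +ₚ T ^ₚ M *ₚ dropₚ M (ω p n)
        ≈⟨ Λ.+-cong (Λ.trans (Λ.*-congʳ {g} (Λ.sym (C[natR]^ₚ p m))) (*ₚ-comm (C (natR p) ^ₚ m) g)) (*ₚ-comm (T ^ₚ M) (dropₚ M (ω p n))) ⟩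
      g *ₚ C (natR p) ^ₚ m +ₚ dropₚ M (ω p n) *ₚ T ^ₚ M    ∎)
      where
      M = p ℕ.^ suc m
      pᵐ∣ω : ∀ k → k ℕ.< M → natR (p ℕ.^ m) ∣ ω p n k
      pᵐ∣ω zero      _   = ∣ʳ-respʳ-≈ (R.sym (ω-coeff-zero p n)) (_ ∣0)
      pᵐ∣ω k@(suc _) k<M = ∣ʳ-respʳ-≈ (R.sym (ω-coeff p n z<s))
        (natR-mono-∣ (∣-trans (p^a∣p^b p m≤n∸m) (p^[n∸v]∣p^nCk p-prime n m z<s k<M)))
      g : PS
      g = proj₁ (∣-below⇒≈C*ₚ+T^ₚ*ₚdropₚ M (natR (p ℕ.^ m)) (ω p n) pᵐ∣ω)
      ω≈ : ω p n ≈ₚ C (natR (p ℕ.^ m)) *ₚ g +ₚ T ^ₚ M *ₚ dropₚ M (ω p n)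
      ω≈ = proj₂ (∣-below⇒≈C*ₚ+T^ₚ*ₚdropₚ M (natR (p ℕ.^ m)) (ω p n) pᵐ∣ω)

    ω[1+m]≈T^p^[1+m]+p*g : ∀ m → Σ PS λ g → ω p (suc m) ≈ₚ T ^ₚ (p ℕ.^ suc m) +ₚ C (natR p) *ₚ g
    ω[1+m]≈T^p^[1+m]+p*g m = g , (begin
      ω p (suc m)                                       ≈⟨ ω≈ ⟩
      C (natR p) *ₚ g +ₚ T ^ₚ M *ₚ dropₚ M (ω p (suc m)) ≈⟨ Λ.+-comm (C (natR p) *ₚ g) _ ⟩
      T ^ₚ M *ₚ dropₚ M (ω p (suc m)) +ₚ C (natR p) *ₚ g
        ≈⟨ Λ.+-congʳ (Λ.trans (Λ.*-congˡ dropₚ-ω≈𝟙ₚ) (Λ.*-identityʳ (T ^ₚ M))) ⟩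
      T ^ₚ M +ₚ C (natR p) *ₚ g                           ∎)
      where
      M = p ℕ.^ suc m
      p∣ω : ∀ k → k ℕ.< M → natR p ∣ ω p (suc m) k
      p∣ω zero      _   = ∣ʳ-respʳ-≈ (R.sym (ω-coeff-zero p (suc m))) (_ ∣0)
      p∣ω k@(suc _) k<M = ∣ʳ-respʳ-≈ (R.sym (ω-coeff p (suc m) z<s)) (natR-mono-∣ (p∣p^[1+v]Ck p-prime m z<s k<M))
      g : PS
      g = proj₁ (∣-below⇒≈C*ₚ+T^ₚ*ₚdropₚ M (natR p) (ω p (suc m)) p∣ω)
      ω≈ : ω p (suc m) ≈ₚ C (natR p) *ₚ g +ₚ T ^ₚ M *ₚ dropₚ M (ω p (suc m))
      ω≈ = proj₂ (∣-below⇒≈C*ₚ+T^ₚ*ₚdropₚ M (natR p) (ω p (suc m)) p∣ω)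
      dropₚ-ω≈𝟙ₚ : dropₚ M (ω p (suc m)) ≈ₚ 𝟙ₚ
      dropₚ-ω≈𝟙ₚ j = R.trans (ω-coeff p (suc m) (<-≤-trans (m^n>0 p (suc m)) (m≤m+n M j))) (MC[M+j]≈𝟙ₚ j)
        where
        MC[M+j]≈𝟙ₚ : ∀ j → natR (M choose (M ℕ.+ j)) R.≈ 𝟙ₚ j
        MC[M+j]≈𝟙ₚ zero    = R.trans (R.reflexive (≡.cong natR (≡.trans (≡.cong (M choose_) (+-identityʳ M)) (nCn≡1 M))))
                                     (R.+-identityʳ R.1#)
        MC[M+j]≈𝟙ₚ (suc j) = R.reflexive (≡.cong natR (k>n⇒nCk≡0 (m<m+n M z<s)))

    T^N∈⟨pᵐ,ω[1+m]⟩ : ∀ m N → m ℕ.* p ℕ.^ suc m ℕ.≤ N → (T ^ₚ N) ∈⟨ ⟨ C (natR p) ^ₚ m , ω p (suc m) ⟩ ⟩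
    T^N∈⟨pᵐ,ω[1+m]⟩ m N K≤N = ∈⟨,⟩-intro {a = P} {w} (r *ₚ b) (r *ₚ a) (begin
      T ^ₚ N                                  ≡⟨ ≡.cong (T ^ₚ_) (m∸n+n≡m K≤N) ⟨
      T ^ₚ (N ∸ K ℕ.+ K)                      ≈⟨ ^ₚ-homo-+ T (N ∸ K) K ⟩
      r *ₚ T ^ₚ (m ℕ.* M)                     ≈⟨ Λ.*-congˡ (Λ.trans (^ₚ-* T m M) (^ₚ≈^ (T ^ₚ M) m)) ⟩
      r *ₚ (T ^ₚ M) ^ m                       ≈⟨ Λ.*-congˡ [T^M]^m≈ ⟩
      r *ₚ (a *ₚ w +ₚ b *ₚ C (natR p) ^ m)    ≈⟨ Λ.*-congˡ (Λ.+-congˡ {a *ₚ w} (Λ.*-congˡ (Λ.sym (^ₚ≈^ (C (natR p)) m)))) ⟩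
      r *ₚ (a *ₚ w +ₚ b *ₚ P)                 ≈⟨ Λ.distribˡ r (a *ₚ w) (b *ₚ P) ⟩
      r *ₚ (a *ₚ w) +ₚ r *ₚ (b *ₚ P)          ≈⟨ Λ.+-comm (r *ₚ (a *ₚ w)) _ ⟩
      r *ₚ (b *ₚ P) +ₚ r *ₚ (a *ₚ w)          ≈⟨ Λ.+-cong (Λ.*-assoc r b P) (Λ.*-assoc r a w) ⟨
      r *ₚ b *ₚ P +ₚ r *ₚ a *ₚ w              ∎)
      where
      M = p ℕ.^ suc m
      K = m ℕ.* M
      r = T ^ₚ (N ∸ K)
      w = ω p (suc m)
      P = C (natR p) ^ₚ m
      g : PS
      g = proj₁ (ω[1+m]≈T^p^[1+m]+p*g m)
      T^M≈w+p*[-g] : T ^ₚ M ≈ₚ w +ₚ C (natR p) *ₚ Λ.- g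
      T^M≈w+p*[-g] = begin
        T ^ₚ M                                              ≈⟨ Λ.+-identityʳ (T ^ₚ M) ⟨
        T ^ₚ M +ₚ 𝟘ₚ                                        ≈⟨ Λ.+-congˡ (Λ.trans (Λ.*-congˡ (Λ.-‿inverseʳ g)) (Λ.zeroʳ (C (natR p)))) ⟨
        T ^ₚ M +ₚ C (natR p) *ₚ (g Λ.- g)                   ≈⟨ Λ.+-congˡ (Λ.distribˡ (C (natR p)) g (Λ.- g)) ⟩
        T ^ₚ M +ₚ (C (natR p) *ₚ g +ₚ C (natR p) *ₚ Λ.- g)  ≈⟨ Λ.+-assoc (T ^ₚ M) _ _ ⟨
        T ^ₚ M +ₚ C (natR p) *ₚ g +ₚ C (natR p) *ₚ Λ.- g    ≈⟨ Λ.+-congʳ (proj₂ (ω[1+m]≈T^p^[1+m]+p*g m)) ⟨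
        w +ₚ C (natR p) *ₚ Λ.- g                            ∎
      power = x≈w+y*z⇒x^j≈a*w+b*y^j Λ.commutativeSemiring {z = Λ.- g} T^M≈w+p*[-g] m
      a b : PS
      a = proj₁ power
      b = proj₁ (proj₂ power)
      [T^M]^m≈ : (T ^ₚ M) ^ m ≈ₚ a *ₚ w +ₚ b *ₚ C (natR p) ^ m
      [T^M]^m≈ = proj₂ (proj₂ power)

open import Data.Nat using (ℕ; suc; _^_; _≤_; _<_; _/_; _*_)
open import Data.Nat.Primality using (Prime)
open import Data.Product using (_×_)

lemma2p1 : ∀ {c ℓ : Level} (R : CommutativeRing c ℓ) (π : CommutativeRing.Carrier R)
    (p : ℕ) → Prime p → 3 ≤ p →
    let open PowerSeries R in
    (∀ n → 1 ≤ n →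
      (maxPow π (2 * n) ⊆⟨⟩ ⟨ C π ^ₚ n , T ^ₚ n ⟩)
      × (⟨ C π ^ₚ n , T ^ₚ n ⟩ ⊆⟨⟩ maxPow π n))
    × (∀ n → 1 ≤ n →
      ω p n ∈⟨ ⟨ C (natR p) ^ₚ (n / 2) , T ^ₚ (p ^ (suc (n / 2))) ⟩ ⟩)
    × (∀ N n → 1 ≤ N → p ^ n ≤ N → N < p ^ suc n →
      (T ^ₚ N) ∈⟨ ⟨ C (natR p) ^ₚ (n / 2) , ω p (suc (n / 2)) ⟩ ⟩)
-- The argument works for every prime.
lemma2p1 R π p p-prime _ =
    (λ n _ → maxPow[2n]⊆⟨πⁿ,Tⁿ⟩ π n , ⟨πⁿ,Tⁿ⟩⊆maxPow[n] π n)
  , (λ n _ → ω∈⟨pᵐ,T^p^[1+m]⟩ p-prime n (n / 2) (n/2≤n∸n/2 n))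
  , (λ N n _ p^n≤N _ → T^N∈⟨pᵐ,ω[1+m]⟩ p-prime (n / 2) N (begin
      n / 2 * p ^ suc (n / 2)  ≤⟨ m*p^[1+m]≤p^[m+m] 2≤p (n / 2) ⟩
      p ^ (n / 2 + n / 2)      ≤⟨ ^-monoʳ-≤ p (n/2+n/2≤n n) ⟩
      p ^ n                    ≤⟨ p^n≤N ⟩
      N                        ∎))
  where
  open IdealMemberships R
  open PowerBounds
  open import Data.Nat using (_+_; nonTrivial⇒n>1)
  open import Data.Nat.Properties using (^-monoʳ-≤; module ≤-Reasoning)
  open import Data.Nat.Primality using (prime⇒nonZero; prime⇒nonTrivial)
  open ≤-Reasoning
  instance _ = prime⇒nonZero p-prime
  2≤p : 2 ≤ p
  2≤p = nonTrivial⇒n>1 p {{prime⇒nonTrivial p-prime}}
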